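{- For every $d,k>0$ it is $g(B_{d,k}) = O(2^d n\log\log n/\log n)$.
   Context: For $k>0$, $D_k$ is a binary de Bruijn sequence of length $n=2^k+k-1$ containing every binary string of length $k$ exactly once. For $d>0$, $B_{d,k}$ is the $d$-dimensional array of size $n\times\cdots\times n$ ($d$ times) over the alphabet $\{\langle b_1,\ldots,b_d\rangle : b_i\in\{\texttt{0},\texttt{1}\}\}$ defined by $B_{d,k}[i_1]\cdots[i_d]=\langle D_k[i_1],\ldots,D_k[i_d]\rangle$. For $i\in[1,d]$, the concatenation $A\oplus_{(i)} B$ (written in the paper with a rotated $\ominus$ symbol subscripted by $(i)$) of two $d$-dimensional arrays with equal sizes in every dimension other than $i$ places $B$ after $A$ along dimension $i$. A $d$D SLP is a context-free grammar uniquely generating the array with rules $A\to a$ ($a$ a terminal, size 1) or $A\to B\oplus_{(i)} C$ ($i\in[1,d]$, size 2), with the natural expansions; $g$ is the size of the smallest $d$D SLP generating the array. -}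

module Defs where

open import Data.Nat using (ℕ; zero; suc; _+_; _*_; _∸_; _^_; _≤_; _<_; _<ᵇ_)
open import Data.Nat.Properties using (_≟_)
open import Data.Nat.Logarithm using (⌊log₂_⌋)
open import Data.Fin using (Fin; toℕ) renaming (zero to fzero; suc to fsuc)
import Data.Fin.Properties as FinP
open import Data.Bool using (Bool; false; true; if_then_else_)
open import Data.Vec using (Vec; []; _∷_; lookup; tabulate)
open import Data.Maybe using (Maybe; just; nothing)
open import Data.Product using (Σ; ∃; ∃-syntax; _×_; _,_)
open import Data.Sum using (_⊎_)
open import Relation.Nullary using (yes; no)
open import Relation.Nullary.Decidable using (_⊎-dec_)
open import Relation.Binary.PropositionalEquality using (_≡_)

len : ℕ → ℕ
len k = 2 ^ k + k ∸ 1

-- total lookup into a vector by a natural-number index (0-based);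
-- out-of-range indices are never used below.
at : ∀ {n} → Vec Bool n → ℕ → Bool
at []       _       = false
at (b ∷ _)  zero    = b
at (_ ∷ bs) (suc i) = at bs i

OccursAt : ∀ {n k} → Vec Bool n → Vec Bool k → ℕ → Set
OccursAt {k = k} D w p = (t : Fin k) → at D (p + toℕ t) ≡ lookup w t

-- D (of length 2^k+k-1) contains every binary string of length k exactly
-- once.  The valid start positions p (those with p + k ≤ n) are p < 2^k.
IsDeBruijn : (k : ℕ) → Vec Bool (len k) → Set
IsDeBruijn k D =
  (w : Vec Bool k) →
    (∃[ p ] (p < 2 ^ k × OccursAt D w p))
  × (∀ p q → p < 2 ^ k → q < 2 ^ k → OccursAt D w p → OccursAt D w q → p ≡ q)

record Array (d : ℕ) (A : Set) : Set where
  constructor arr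
  field
    shape : Fin d → ℕ
    entry : (Fin d → ℕ) → A     -- only meaningful on in-bound indices
open Array public

InBounds : ∀ {d A} → Array d A → (Fin d → ℕ) → Set
InBounds X x = ∀ i → x i < shape X i

_≈A_ : ∀ {d A} → Array d A → Array d A → Set
X ≈A Y = (∀ i → shape X i ≡ shape Y i) × (∀ x → InBounds X x → entry X x ≡ entry Y x)

unit : ∀ {d A} → A → Array d A
unit a = arr (λ _ → 1) (λ _ → a)

upd : ∀ {d} → (Fin d → ℕ) → Fin d → ℕ → (Fin d → ℕ)
upd x i v j with FinP._≟_ j i
... | yes _ = v
... | no  _ = x j

-- X ⊕_(i) Y : Y placed after X along dimension i (assumes compatible sizes)
cat : ∀ {d A} → Fin d → Array d A → Array d A → Array d A
cat i X Y = arr sh en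
  where
  sh : _ → ℕ
  sh j with FinP._≟_ j i
  ... | yes _ = shape X j + shape Y j
  ... | no  _ = shape X j
  en : _ → _
  en x = if x i <ᵇ shape X i then entry X x else entry Y (upd x i (x i ∸ shape X i))

Compatible : ∀ {d A} → Fin d → Array d A → Array d A → Set
Compatible i X Y = ∀ j → j ≡ i ⊎ shape X j ≡ shape Y j

data Rule (d : ℕ) (A : Set) (m : ℕ) : Set where
  term : A → Rule d A m
  conc : Fin d → Fin m → Fin m → Rule d A m

ruleSize : ∀ {d A m} → Rule d A m → ℕ
ruleSize (term _)     = 1
ruleSize (conc _ _ _) = 2

-- an SLP with m nonterminals; nonterminal 0 is the most recently added
data SLP (d : ℕ) (A : Set) : ℕ → Set where
  []  : SLP d A 0
  _▷_ : ∀ {m} → SLP d A m → Rule d A m → SLP d A (suc m)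

size : ∀ {d A m} → SLP d A m → ℕ
size []      = 0
size (G ▷ r) = size G + ruleSize r

catM : ∀ {d A} → Fin d → Maybe (Array d A) → Maybe (Array d A) → Maybe (Array d A)
catM i (just X) (just Y) with FinP.all? (λ j → FinP._≟_ j i ⊎-dec (shape X j ≟ shape Y j))
... | yes _ = just (cat i X Y)
... | no  _ = nothing
catM i _ _ = nothing

-- expansion of each nonterminal (nothing = ill-formed concatenation)
eval : ∀ {d A m} → SLP d A m → Fin m → Maybe (Array d A)
eval (G ▷ term a)     fzero    = just (unit a)
eval (G ▷ conc i p q) fzero    = catM i (eval G p) (eval G q)
eval (G ▷ _)          (fsuc j) = eval G j

Generates : ∀ {d A m} → SLP d A (suc m) → Array d A → Set
Generates G X = ∃[ Y ] (eval G fzero ≡ just Y × Y ≈A X)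

B : (d k : ℕ) → Vec Bool (len k) → Array d (Vec Bool d)
B d k D = arr (λ _ → len k) (λ x → tabulate (λ i → at D (x i)))

-- B_{d,k} is the d-fold outer power of one binary word f = D of length n, and
-- such a power can be generated one axis at a time.  The array whose first j+1
-- axes run over f while the remaining axes are fixed to letters is, along axis
-- j, a line of n slices, each equal to one of the two arrays in which axis j is
-- fixed to 0 or to 1.  Using these two as letters, a dictionary of all words of
-- length at most b+1 costs fewer than 2^(b+2) rules, after which the line is
-- chained from about n/(b+1) blocks; with b ≈ k/2 ≈ (log n)/2 one step costs
-- F = O(n / log n) rules.  Repeating the step for every choice of the letters
-- on the later axes gives O(2^d F) rules, i.e. g(B_{d,k}) log n = O(2^d n),
-- which is stronger than the claim since log log n ≥ 1.
module Submission where

open import Defs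
open import Data.Nat using (ℕ; zero; suc; _+_; _*_; _∸_; _^_; _≤_; _<_; _<ᵇ_; z≤n; s≤s; ⌊_/2⌋)
open import Data.Nat.Properties
open import Data.Nat.DivMod using (_/_; _%_; m≡m%n+[m/n]*n; m%n<n)
open import Data.Nat.Logarithm using (⌊log₂_⌋; ⌊log₂⌋-mono-≤; ⌊log₂[2^n]⌋≡n)
open import Data.Nat.Tactic.RingSolver using (solve-∀)
open import Data.Bool using (Bool; true; false; if_then_else_)
open import Data.Vec using (Vec; []; _∷_; tabulate)
open import Data.Vec.Properties using (tabulate-cong)
open import Data.Vec.Functional using (updateAt)
open import Data.Vec.Functional.Properties using (updateAt-updates; updateAt-minimal)
open import Data.Fin using (Fin; toℕ; fromℕ<) renaming (zero to fzero; suc to fsuc)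
open import Data.Fin.Properties using (toℕ<n; toℕ-fromℕ<; toℕ-injective)
  renaming (_≟_ to _≟ᶠ_; all? to allᶠ?)
open import Data.Maybe using (just)
open import Data.Product using (∃-syntax; _×_; _,_; proj₁; proj₂)
open import Data.Sum using (inj₁; inj₂)
open import Data.Empty using (⊥)
open import Function using (_∘_; const)
open import Relation.Nullary using (yes; no; ¬_; contradiction)
open import Relation.Nullary.Decidable using (_⊎-dec_)
open import Relation.Binary.PropositionalEquality


module _ {d : ℕ} {A : Set} where

  ≈A-refl : {X : Array d A} → X ≈A X
  ≈A-refl = (λ _ → refl) , (λ _ _ → refl)

  ≈A-trans : {X Y Z : Array d A} → X ≈A Y → Y ≈A Z → X ≈A Z
  ≈A-trans (sXY , eXY) (sYZ , eYZ) =
    (λ j → trans (sXY j) (sYZ j)) ,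
    (λ x inX → trans (eXY x inX) (eYZ x (λ j → subst (x j <_) (sXY j) (inX j))))

  module _ (i : Fin d) where

    Compatible-≢ : {X Y : Array d A} → Compatible i X Y → ∀ {j} → j ≢ i → shape X j ≡ shape Y j
    Compatible-≢ compat {j} j≢i with compat j
    ... | inj₁ j≡i = contradiction j≡i j≢i
    ... | inj₂ eq  = eq

    Compatible-≈ : {X X' Y Y' : Array d A} → X ≈A X' → Y ≈A Y' → Compatible i X' Y' → Compatible i X Y
    Compatible-≈ (sX , _) (sY , _) compat j with compat j
    ... | inj₁ j≡i = inj₁ j≡i
    ... | inj₂ eq  = inj₂ (trans (sX j) (trans eq (sym (sY j))))

    catM-compatible : {X Y : Array d A} → Compatible i X Y → catM i (just X) (just Y) ≡ just (cat i X Y)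
    catM-compatible {X} {Y} compat with allᶠ? (λ j → j ≟ᶠ i ⊎-dec (shape X j ≟ shape Y j))
    ... | yes _   = refl
    ... | no ¬all = contradiction compat ¬all

    shape-cat-≡ : ∀ (X Y : Array d A) → shape (cat i X Y) i ≡ shape X i + shape Y i
    shape-cat-≡ X Y with i ≟ᶠ i
    ... | yes _   = refl
    ... | no i≢i = contradiction refl i≢i

    shape-cat-≢ : ∀ (X Y : Array d A) {j} → j ≢ i → shape (cat i X Y) j ≡ shape X j
    shape-cat-≢ X Y {j} j≢i with j ≟ᶠ i
    ... | yes j≡i = contradiction j≡i j≢i
    ... | no _    = refl

    entry-cat-< : ∀ (X Y : Array d A) x → x i < shape X i → entry (cat i X Y) x ≡ entry X x
    entry-cat-< X Y x lt with x i <ᵇ shape X i | <⇒<ᵇ lt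
    ... | true | _ = refl

    entry-cat-≥ : ∀ (X Y : Array d A) x → shape X i ≤ x i →
                  entry (cat i X Y) x ≡ entry Y (upd x i (x i ∸ shape X i))
    entry-cat-≥ X Y x ge with x i <ᵇ shape X i | <ᵇ⇒< (x i) (shape X i)
    ... | false | _  = refl
    ... | true  | lt = contradiction (lt _) (≤⇒≯ ge)

    inBounds-catˡ : ∀ {X Y : Array d A} {x} → InBounds (cat i X Y) x → x i < shape X i → InBounds X x
    inBounds-catˡ {X} {Y} {x} inXY lt j with j ≟ᶠ i
    ... | yes refl = lt
    ... | no j≢i   = subst (x j <_) (shape-cat-≢ X Y j≢i) (inXY j)

    inBounds-catʳ : ∀ {X Y : Array d A} {x} → Compatible i X Y → InBounds (cat i X Y) x →
                    shape X i ≤ x i → InBounds Y (upd x i (x i ∸ shape X i))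
    inBounds-catʳ {X} {Y} {x} compat inXY ge j with j ≟ᶠ i
    ... | yes refl = +-cancelˡ-< (shape X j) _ _
                       (subst₂ _<_ (sym (m+[n∸m]≡n ge)) (shape-cat-≡ X Y) (inXY j))
    ... | no j≢i   = subst (x j <_) (trans (shape-cat-≢ X Y j≢i) (Compatible-≢ {X} {Y} compat j≢i)) (inXY j)

    cat-cong : ∀ {X X' Y Y' : Array d A} → Compatible i X Y → X ≈A X' → Y ≈A Y' →
               cat i X Y ≈A cat i X' Y'
    cat-cong {X} {X'} {Y} {Y'} compat (sX , eX) (sY , eY) = shapes , entries
      where
      shapes : ∀ j → shape (cat i X Y) j ≡ shape (cat i X' Y') j
      shapes j with j ≟ᶠ i
      ... | yes _ = cong₂ _+_ (sX j) (sY j)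
      ... | no _  = sX j
      open ≡-Reasoning
      entries : ∀ x → InBounds (cat i X Y) x → entry (cat i X Y) x ≡ entry (cat i X' Y') x
      entries x inXY with x i <? shape X i
      ... | yes lt = begin
        entry (cat i X Y) x   ≡⟨ entry-cat-< X Y x lt ⟩
        entry X x             ≡⟨ eX x (inBounds-catˡ inXY lt) ⟩
        entry X' x            ≡⟨ entry-cat-< X' Y' x (subst (x i <_) (sX i) lt) ⟨
        entry (cat i X' Y') x ∎
      ... | no ¬lt = begin
        entry (cat i X Y) x                    ≡⟨ entry-cat-≥ X Y x ge ⟩
        entry Y (upd x i (x i ∸ shape X i))    ≡⟨ eY _ (inBounds-catʳ compat inXY ge) ⟩
        entry Y' (upd x i (x i ∸ shape X i))   ≡⟨ cong (λ s → entry Y' (upd x i (x i ∸ s))) (sX i) ⟩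
        entry Y' (upd x i (x i ∸ shape X' i))  ≡⟨ entry-cat-≥ X' Y' x (subst (_≤ x i) (sX i) ge) ⟨
        entry (cat i X' Y') x                  ∎
        where ge = ≮⇒≥ ¬lt


module _ {d : ℕ} {A : Set} where

  data _≼_ : ∀ {m m'} → SLP d A m → SLP d A m' → Set where
    ≼-refl : ∀ {m} {G : SLP d A m} → G ≼ G
    ≼-step : ∀ {m m'} {G : SLP d A m} {G' : SLP d A m'} {r} → G ≼ G' → G ≼ (G' ▷ r)

  ≼-trans : ∀ {m m' m''} {G : SLP d A m} {G' : SLP d A m'} {G'' : SLP d A m''} →
            G ≼ G' → G' ≼ G'' → G ≼ G''
  ≼-trans e ≼-refl      = e
  ≼-trans e (≼-step e') = ≼-step (≼-trans e e')

  lift : ∀ {m m'} {G : SLP d A m} {G' : SLP d A m'} → G ≼ G' → Fin m → Fin m'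
  lift ≼-refl     p = p
  lift (≼-step e) p = fsuc (lift e p)

  eval-lift : ∀ {m m'} {G : SLP d A m} {G' : SLP d A m'} (e : G ≼ G') p → eval G' (lift e p) ≡ eval G p
  eval-lift ≼-refl                        p = refl
  eval-lift (≼-step {r = term _} e)       p = eval-lift e p
  eval-lift (≼-step {r = conc _ _ _} e)   p = eval-lift e p

  ruleSize≤2 : ∀ {m} (r : Rule d A m) → ruleSize r ≤ 2
  ruleSize≤2 (term _)     = s≤s z≤n
  ruleSize≤2 (conc _ _ _) = ≤-refl

  size≤2*rules : ∀ {m} (G : SLP d A m) → size G ≤ 2 * m
  size≤2*rules []            = z≤n
  size≤2*rules {suc m} (G ▷ r) =
    ≤-trans (+-mono-≤ (size≤2*rules G) (ruleSize≤2 r))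
            (≤-reflexive (trans (+-comm (2 * m) 2) (sym (*-suc 2 m))))

  record _⊢_ {m} (G : SLP d A m) (X : Array d A) : Set where
    constructor derives
    field
      node      : Fin m
      expansion : Array d A
      evaluates : eval G node ≡ just expansion
      matches   : expansion ≈A X

  ⊢-mono : ∀ {m m'} {G : SLP d A m} {G' : SLP d A m'} {X} → G ≼ G' → G ⊢ X → G' ⊢ X
  ⊢-mono e (derives p Y evY Y≈X) = derives (lift e p) Y (trans (eval-lift e p) evY) Y≈X

  ⊢-≈ : ∀ {m} {G : SLP d A m} {X X'} → G ⊢ X → X ≈A X' → G ⊢ X'
  ⊢-≈ (derives p Y evY Y≈X) X≈X' = derives p Y evY (≈A-trans Y≈X X≈X')

  Generates′ : Array d A → ∀ {m} → SLP d A m → Set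
  Generates′ X []      = ⊥
  Generates′ X (G ▷ r) = Generates (G ▷ r) X

  Generates′-≈ : ∀ {m} {G : SLP d A m} {X X'} → Generates′ X G → X ≈A X' → Generates′ X' G
  Generates′-≈ {G = _ ▷ _} (Y , evY , Y≈X) X≈X' = Y , evY , ≈A-trans Y≈X X≈X'

  Generates′⇒⊢ : ∀ {m} {G : SLP d A m} {X} → Generates′ X G → G ⊢ X
  Generates′⇒⊢ {G = _ ▷ _} (Y , evY , Y≈X) = derives fzero Y evY Y≈X

  record Extension {m} (G : SLP d A m) (c : ℕ) (Q : ∀ {m'} → SLP d A m' → Set) : Set where
    constructor extension
    field
      {m'}    : ℕ
      grammar : SLP d A m'
      extends : G ≼ grammar
      bound   : m' ≤ m + c
      holds   : Q grammar

  module _ {m} {G : SLP d A m} {Q : ∀ {m'} → SLP d A m' → Set} where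

    return : Q G → Extension G 0 Q
    return q = extension G ≼-refl (m≤m+n m 0) q

    _>>=_ : ∀ {a b} {R : ∀ {m'} → SLP d A m' → Set} → Extension G a Q →
            (∀ {m'} {G' : SLP d A m'} → G ≼ G' × Q G' → Extension G' b R) → Extension G (a + b) R
    _>>=_ {a} {b} (extension G₁ e₁ bd₁ q₁) k with k (e₁ , q₁)
    ... | extension G₂ e₂ bd₂ r₂ =
      extension G₂ (≼-trans e₁ e₂)
        (≤-trans bd₂ (≤-trans (+-monoˡ-≤ b bd₁) (≤-reflexive (+-assoc m a b)))) r₂

    _<$>_ : ∀ {c} {R : ∀ {m'} → SLP d A m' → Set} → (∀ {m'} {G' : SLP d A m'} → Q G' → R G') →
            Extension G c Q → Extension G c R
    h <$> extension G' e bd q = extension G' e bd (h q)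

    relax : ∀ {a b} → a ≤ b → Extension G a Q → Extension G b Q
    relax a≤b (extension G' e bd q) = extension G' e (≤-trans bd (+-monoʳ-≤ m a≤b)) q

  module _ {m} {G : SLP d A m} where

    add-term : ∀ a → Extension G 1 (Generates′ (unit a))
    add-term a = extension (G ▷ term a) (≼-step ≼-refl) (≤-reflexive (+-comm 1 m)) (unit a , refl , ≈A-refl)

    add-conc : ∀ i {X Y Z} → G ⊢ X → G ⊢ Y → Compatible i X Y → cat i X Y ≈A Z →
               Extension G 1 (Generates′ Z)
    add-conc i (derives p X' evX X'≈X) (derives q Y' evY Y'≈Y) compat catXY≈Z =
      extension (G ▷ conc i p q) (≼-step ≼-refl) (≤-reflexive (+-comm 1 m))
        (cat i X' Y' ,
         trans (cong₂ (catM i) evX evY) (catM-compatible i compat') ,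
         ≈A-trans (cat-cong i compat' X'≈X Y'≈Y) catXY≈Z)
      where compat' = Compatible-≈ i X'≈X Y'≈Y compat

  add-all : ∀ r {m} {G : SLP d A m} (X : Vec Bool r → Array d A) →
            (∀ {m'} {G' : SLP d A m'} → G ≼ G' → ∀ w → Extension G' 1 (Generates′ (X w))) →
            Extension G (2 ^ r) (λ G' → ∀ w → G' ⊢ X w)
  add-all zero    X step = (λ gen → λ { [] → Generates′⇒⊢ gen }) <$> step ≼-refl []
  add-all (suc r) X step = do
    (e₀ , X₀) ← add-all r (X ∘ (false ∷_)) (λ e → step e ∘ (false ∷_))
    (e₁ , X₁) ← add-all r (X ∘ (true ∷_)) (λ e → step (≼-trans e₀ e) ∘ (true ∷_))
    return λ { (false ∷ w) → ⊢-mono e₁ (X₀ w) ; (true ∷ w) → X₁ w }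


record Word : Set where
  constructor word
  field
    length  : ℕ
    letters : ℕ → Bool
open Word

_≐_ : Word → Word → Set
u ≐ v = length u ≡ length v × (∀ t → t < length u → letters u t ≡ letters v t)

≐-reflexive : ∀ {u v} → u ≡ v → u ≐ v
≐-reflexive refl = refl , λ _ _ → refl

singleton-≐ : ∀ w → word 1 (const (w 0)) ≐ word 1 w
singleton-≐ w = refl , λ { zero _ → refl ; (suc _) (s≤s ()) }

at-tabulate : ∀ {r} (w : ℕ → Bool) t → t < r → at (tabulate {n = r} (w ∘ toℕ)) t ≡ w t
at-tabulate {suc r} w zero    _          = refl
at-tabulate {suc r} w (suc t) (s≤s t<r) = at-tabulate (w ∘ suc) t t<r

BitSLP : ℕ → ℕ → Set
BitSLP d = SLP d (Vec Bool d)

module _ {d : ℕ} where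

  outer : (Fin d → Word) → Array d (Vec Bool d)
  outer ws = arr (length ∘ ws) (λ x → tabulate (λ j → letters (ws j) (x j)))

  outer-cong : ∀ {ws ws' : Fin d → Word} → (∀ j → ws j ≐ ws' j) → outer ws ≈A outer ws'
  outer-cong ws≐ws' = (λ j → proj₁ (ws≐ws' j)) ,
                      (λ x inX → tabulate-cong (λ j → proj₂ (ws≐ws' j) (x j) (inX j)))

  line : (Fin d → Word) → Fin d → Word → Array d (Vec Bool d)
  line ws i u = outer (updateAt ws i (const u))

  module _ (ws : Fin d → Word) (i : Fin d) where

    private
      at-i : ∀ u → updateAt ws i (const u) i ≡ u
      at-i u = updateAt-updates i ws

      off-i : ∀ u {j} → j ≢ i → updateAt ws i (const u) j ≡ ws j
      off-i u {j} j≢i = updateAt-minimal j i ws j≢i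

    line-compatible : ∀ u v → Compatible i (line ws i u) (line ws i v)
    line-compatible u v j with j ≟ᶠ i
    ... | yes j≡i = inj₁ j≡i
    ... | no j≢i  = inj₂ (cong length (trans (off-i u j≢i) (sym (off-i v j≢i))))

    line-cong : ∀ {u v} → u ≐ v → line ws i u ≈A line ws i v
    line-cong {u} {v} u≐v = outer-cong coords
      where
      coords : ∀ j → updateAt ws i (const u) j ≐ updateAt ws i (const v) j
      coords j with j ≟ᶠ i
      ... | yes refl = subst₂ _≐_ (sym (at-i u)) (sym (at-i v)) u≐v
      ... | no j≢i   = ≐-reflexive (trans (off-i u j≢i) (sym (off-i v j≢i)))

    line-cat : ∀ {L₁ L₂ L w₁ w₂ w} → L₁ + L₂ ≡ L →
               (∀ t → t < L₁ → w₁ t ≡ w t) → (∀ t → t < L₂ → w₂ t ≡ w (L₁ + t)) →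
               cat i (line ws i (word L₁ w₁)) (line ws i (word L₂ w₂)) ≈A line ws i (word L w)
    line-cat {L₁} {L₂} {L} {w₁} {w₂} {w} L₁+L₂≡L w₁≡w w₂≡w = shapes , entries
      where
      X = line ws i (word L₁ w₁)
      Y = line ws i (word L₂ w₂)
      Z = line ws i (word L w)
      shapeX : shape X i ≡ L₁
      shapeX = cong length (at-i _)
      letters-off : ∀ u u' {j} → j ≢ i → ∀ t →
                    letters (updateAt ws i (const u) j) t ≡ letters (updateAt ws i (const u') j) t
      letters-off u u' j≢i t = cong (λ v → letters v t) (trans (off-i u j≢i) (sym (off-i u' j≢i)))
      letters-at : ∀ u t → letters (updateAt ws i (const u) i) t ≡ letters u t
      letters-at u t = cong (λ v → letters v t) (at-i u)
      shapes : ∀ j → shape (cat i X Y) j ≡ shape Z j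
      shapes j with j ≟ᶠ i
      ... | yes refl = trans (cong₂ _+_ shapeX (cong length (at-i _)))
                             (trans L₁+L₂≡L (sym (cong length (at-i _))))
      ... | no j≢i   = cong length (trans (off-i _ j≢i) (sym (off-i _ j≢i)))
      open ≡-Reasoning
      entries : ∀ x → InBounds (cat i X Y) x → entry (cat i X Y) x ≡ entry Z x
      entries x inXY with x i <? shape X i
      ... | yes lt = trans (entry-cat-< i X Y x lt) (tabulate-cong coords)
        where
        coords : ∀ j → letters (updateAt ws i (const (word L₁ w₁)) j) (x j)
                       ≡ letters (updateAt ws i (const (word L w)) j) (x j)
        coords j with j ≟ᶠ i
        ... | yes refl = begin
          letters (updateAt ws j (const (word L₁ w₁)) j) (x j) ≡⟨ letters-at _ (x j) ⟩
          w₁ (x j)                                              ≡⟨ w₁≡w (x j) (subst (x j <_) shapeX lt) ⟩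
          w (x j)                                               ≡⟨ letters-at _ (x j) ⟨
          letters (updateAt ws j (const (word L w)) j) (x j)   ∎
        ... | no j≢i   = letters-off _ _ j≢i (x j)
      ... | no ¬lt = trans (entry-cat-≥ i X Y x (≮⇒≥ ¬lt)) (tabulate-cong coords)
        where
        L₁≤xi : L₁ ≤ x i
        L₁≤xi = subst (_≤ x i) shapeX (≮⇒≥ ¬lt)
        xi<L : x i < L₁ + L₂
        xi<L = subst (x i <_) (trans (shape-cat-≡ i X Y) (cong₂ _+_ shapeX (cong length (at-i _)))) (inXY i)
        coords : ∀ j → letters (updateAt ws i (const (word L₂ w₂)) j) (upd x i (x i ∸ shape X i) j)
                       ≡ letters (updateAt ws i (const (word L w)) j) (x j)
        coords j with j ≟ᶠ i
        ... | yes refl = begin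
          letters (updateAt ws j (const (word L₂ w₂)) j) (x j ∸ shape X j) ≡⟨ letters-at _ _ ⟩
          w₂ (x j ∸ shape X j)      ≡⟨ cong (λ s → w₂ (x j ∸ s)) shapeX ⟩
          w₂ (x j ∸ L₁)             ≡⟨ w₂≡w _ (+-cancelˡ-< L₁ _ _ (subst (_< L₁ + L₂) (sym xj≡) xi<L)) ⟩
          w (L₁ + (x j ∸ L₁))       ≡⟨ cong w xj≡ ⟩
          w (x j)                   ≡⟨ letters-at _ (x j) ⟨
          letters (updateAt ws j (const (word L w)) j) (x j) ∎
          where xj≡ = m+[n∸m]≡n L₁≤xi
        ... | no j≢i   = letters-off _ _ j≢i (x j)


module Compression {d : ℕ} (ws : Fin d → Word) (i : Fin d) where

  Line : ℕ → (ℕ → Bool) → Array d (Vec Bool d)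
  Line L w = line ws i (word L w)

  Dictionary : ℕ → ∀ {m} → BitSLP d m → Set
  Dictionary b G = ∀ {r} → r ≤ b → (w : ℕ → Bool) → G ⊢ Line (suc r) w

  Dictionary-mono : ∀ {b m m'} {G : BitSLP d m} {G' : BitSLP d m'} → G ≼ G' → Dictionary b G → Dictionary b G'
  Dictionary-mono e D r≤b w = ⊢-mono e (D r≤b w)

  Dictionary-suc : ∀ {b m} {G : BitSLP d m} → Dictionary b G →
                   (∀ (v : Vec Bool (suc (suc b))) → G ⊢ Line (suc (suc b)) (at v)) → Dictionary (suc b) G
  Dictionary-suc D new r≤1+b w with m≤n⇒m<n∨m≡n r≤1+b
  ... | inj₁ (s≤s r≤b) = D r≤b w
  ... | inj₂ refl      = ⊢-≈ (new (tabulate (w ∘ toℕ))) (line-cong ws i (refl , at-tabulate w))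

  add-prefix : ∀ {b m} {G : BitSLP d m} → Dictionary b G → ∀ x (v : Vec Bool (suc b)) →
               Extension G 1 (Generates′ (Line (suc (suc b)) (at (x ∷ v))))
  add-prefix D x v = add-conc i (D z≤n (const x)) (D ≤-refl (at v)) (line-compatible ws i _ _)
                       (line-cat ws i refl (λ { zero _ → refl ; (suc _) (s≤s ()) }) (λ _ _ → refl))

  dictionary : ∀ b {m} {G : BitSLP d m} → (∀ x → G ⊢ Line 1 (const x)) →
               Extension G (2 ^ suc (suc b)) (Dictionary b)
  dictionary zero    letters =
    relax z≤n (return λ { z≤n w → ⊢-≈ (letters (w 0)) (line-cong ws i (singleton-≐ w)) })
  dictionary (suc b) letters = do
    (e₁ , D)   ← dictionary b letters
    (e₂ , new) ← add-all (suc (suc b)) (λ v → Line (suc (suc b)) (at v))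
                   (λ e → λ { (x ∷ v) → add-prefix (Dictionary-mono e D) x v })
    return (Dictionary-suc (Dictionary-mono e₂ D) new)

  add-block : ∀ {b L L' m} {G : BitSLP d m} → suc b + L ≡ L' → Dictionary b G →
              (f : ℕ → Bool) (s : ℕ) → G ⊢ Line L (λ t → f (s + suc b + t)) →
              Extension G 1 (Generates′ (Line L' (λ t → f (s + t))))
  add-block {b} L≡ D f s rest = add-conc i (D ≤-refl _) rest (line-compatible ws i _ _)
                                  (line-cat ws i L≡ (λ _ _ → refl) (λ t _ → cong f (+-assoc s (suc b) t)))

  chain : ∀ {b r₀ m} {G : BitSLP d m} → r₀ ≤ b → Dictionary b G → (f : ℕ → Bool) → ∀ q s →
          Extension G (suc q) (Generates′ (Line (suc q * suc b + suc r₀) (λ t → f (s + t))))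
  chain {b} {r₀} r₀≤b D f zero    s =
    add-block (cong (_+ suc r₀) (sym (*-identityˡ (suc b)))) D f s (D r₀≤b _)
  chain {b} {r₀} r₀≤b D f (suc q) s = relax (≤-reflexive (cong suc (+-comm q 1))) do
    (e , rest) ← chain r₀≤b D f q (s + suc b)
    add-block (sym (+-assoc (suc b) _ (suc r₀))) (Dictionary-mono e D) f s (Generates′⇒⊢ rest)

  stretch : ∀ {b q r₀ m} {G : BitSLP d m} → r₀ ≤ b → (f : ℕ → Bool) →
            (∀ x → G ⊢ Line 1 (const x)) →
            Extension G (2 ^ suc (suc b) + suc q) (Generates′ (Line (suc q * suc b + suc r₀) f))
  stretch {b} {q} r₀≤b f letters = do
    (_ , D) ← dictionary b letters
    chain r₀≤b D f q 0


<ᵇ-true : ∀ {m n} → m < n → (m <ᵇ n) ≡ true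
<ᵇ-true {m} {n} m<n with m <ᵇ n | <⇒<ᵇ m<n
... | true | _ = refl

<ᵇ-false : ∀ {m n} → ¬ m < n → (m <ᵇ n) ≡ false
<ᵇ-false {m} {n} m≮n with m <ᵇ n | <ᵇ⇒< m n
... | false | _   = refl
... | true  | m<n = contradiction (m<n _) m≮n

<ᵇ-suc : ∀ {m n} → m ≢ n → (m <ᵇ n) ≡ (m <ᵇ suc n)
<ᵇ-suc {zero}  {zero}  m≢n = contradiction refl m≢n
<ᵇ-suc {zero}  {suc n} _   = refl
<ᵇ-suc {suc m} {zero}  _   = refl
<ᵇ-suc {suc m} {suc n} m≢n = <ᵇ-suc (m≢n ∘ cong suc)

module Levels {d : ℕ} (n : ℕ) (f : ℕ → Bool) where

  axis : Bool → Bool → Word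
  axis full x = if full then word n f else word 1 (const x)

  Level : ℕ → (Fin d → Bool) → Fin d → Word
  Level j c y = axis (toℕ y <ᵇ j) (c y)

  module _ {j : ℕ} {i : Fin d} (i≡j : toℕ i ≡ j) (c : Fin d → Bool) where

    level-letter : ∀ x → outer (Level j (updateAt c i (const x))) ≈A line (Level j c) i (word 1 (const x))
    level-letter x = outer-cong (λ y → ≐-reflexive (coord y))
      where
      coord : ∀ y → Level j (updateAt c i (const x)) y ≡ updateAt (Level j c) i (const (word 1 (const x))) y
      coord y with y ≟ᶠ i
      ... | yes refl = begin
        axis (toℕ y <ᵇ j) cᵢ ≡⟨ cong (λ full → axis full cᵢ) (<ᵇ-false (<-irrefl i≡j)) ⟩
        axis false cᵢ        ≡⟨ cong (axis false) (updateAt-updates y c) ⟩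
        word 1 (const x)     ≡⟨ updateAt-updates y (Level j c) ⟨
        updateAt (Level j c) y (const (word 1 (const x))) y ∎
        where
        open ≡-Reasoning
        cᵢ = updateAt c y (const x) y
      ... | no y≢i = trans (cong (axis _) (updateAt-minimal y i c y≢i))
                           (sym (updateAt-minimal y i (Level j c) y≢i))

    level-stretch : line (Level j c) i (word n f) ≈A outer (Level (suc j) c)
    level-stretch = outer-cong (λ y → ≐-reflexive (coord y))
      where
      coord : ∀ y → updateAt (Level j c) i (const (word n f)) y ≡ Level (suc j) c y
      coord y with y ≟ᶠ i
      ... | yes refl = trans (updateAt-updates y (Level j c))
                             (sym (cong (λ full → axis full (c y)) (<ᵇ-true (≤-reflexive (cong suc i≡j)))))
      ... | no y≢i = trans (updateAt-minimal y i (Level j c) y≢i)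
                           (cong (λ full → axis full (c y))
                                 (<ᵇ-suc (λ y≡j → y≢i (toℕ-injective (trans y≡j (sym i≡j))))))

  level-full : ∀ c → outer (Level d c) ≈A outer (λ _ → word n f)
  level-full c = outer-cong (λ y → ≐-reflexive (cong (λ full → axis full (c y)) (<ᵇ-true (toℕ<n y))))

  module Build (b q r₀ : ℕ) (r₀≤b : r₀ ≤ b) (n≡ : suc q * suc b + suc r₀ ≡ n) where

    F : ℕ
    F = 2 ^ suc (suc b) + suc q

    rules : ℕ → ℕ
    rules zero    = 1
    rules (suc j) = rules j + (rules j + F)

    rules+F≡ : ∀ j → rules j + F ≡ 2 ^ j * (1 + F)
    rules+F≡ zero    = sym (+-identityʳ (1 + F))
    rules+F≡ (suc j) = begin
      rules j + (rules j + F) + F       ≡⟨ regroup (rules j) F ⟩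
      (rules j + F) + (rules j + F)     ≡⟨ cong₂ _+_ (rules+F≡ j) (rules+F≡ j) ⟩
      2 ^ j * (1 + F) + 2 ^ j * (1 + F) ≡⟨ double (2 ^ j) (1 + F) ⟩
      2 ^ suc j * (1 + F)               ∎
      where
      open ≡-Reasoning
      regroup : ∀ a b → a + (a + b) + b ≡ (a + b) + (a + b)
      regroup = solve-∀
      double : ∀ a b → a * b + a * b ≡ 2 * a * b
      double = solve-∀

    build : ∀ j → j ≤ d → ∀ c {m} (G : BitSLP d m) →
            Extension G (rules j) (Generates′ (outer (Level j c)))
    -- toℕ y <ᵇ 0 computes to false, so outer (Level 0 c) is unit (tabulate c) on the nose.
    build zero    _   c G = add-term (tabulate c)
    build (suc j) j<d c G = do
      (e₀ , X₀) ← build j (<⇒≤ j<d) (updateAt c i (const false)) G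
      (e₁ , X₁) ← build j (<⇒≤ j<d) (updateAt c i (const true)) _
      (λ X → Generates′-≈ X (≈A-trans (line-cong (Level j c) i (n≡ , λ _ _ → refl)) (level-stretch i≡j c)))
        <$> Compression.stretch (Level j c) i r₀≤b f
              λ { false → ⊢-mono e₁ (letter X₀) ; true → letter X₁ }
      where
      i = fromℕ< j<d
      i≡j = toℕ-fromℕ< j<d
      letter : ∀ {x m'} {G' : BitSLP d m'} → Generates′ (outer (Level j (updateAt c i (const x)))) G' →
               G' ⊢ line (Level j c) i (word 1 (const x))
      letter X = ⊢-≈ (Generates′⇒⊢ X) (level-letter i≡j c _)

outer-power-slp : ∀ d n (f : ℕ → Bool) b q r₀ → r₀ ≤ b → suc q * suc b + suc r₀ ≡ n →
  ∃[ m ] ∃[ G ] (Generates {d} {Vec Bool d} {m} G (outer (λ _ → word n f)) ×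
                 size G ≤ 2 * (2 ^ d * (1 + (2 ^ suc (suc b) + suc q))))
outer-power-slp d n f b q r₀ r₀≤b n≡ = finish (build d ≤-refl (const false) [])
  where
  open Levels {d} n f
  open Build b q r₀ r₀≤b n≡
  open ≤-Reasoning
  finish : Extension [] (rules d) (Generates′ (outer (Level d (const false)))) →
           ∃[ m ] ∃[ G ] (Generates {d} {Vec Bool d} {m} G (outer (λ _ → word n f)) ×
                          size G ≤ 2 * (2 ^ d * (1 + F)))
  finish (extension [] _ _ ())
  finish (extension {suc m} (G ▷ r) _ rules≤ X) =
    m , G ▷ r , Generates′-≈ {G = G ▷ r} X (level-full _) , (begin
    size (G ▷ r)          ≤⟨ size≤2*rules (G ▷ r) ⟩
    2 * suc m             ≤⟨ *-monoʳ-≤ 2 rules≤ ⟩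
    2 * rules d           ≤⟨ *-monoʳ-≤ 2 (m≤m+n (rules d) F) ⟩
    2 * (rules d + F)     ≡⟨ cong (2 *_) (rules+F≡ d) ⟩
    2 * (2 ^ d * (1 + F)) ∎)


n<2^n : ∀ n → n < 2 ^ n
n<2^n zero    = s≤s z≤n
n<2^n (suc n) = begin-strict
  suc n           <⟨ s≤s (n<2^n n) ⟩
  1 + 2 ^ n       ≤⟨ +-monoˡ-≤ (2 ^ n) (m^n>0 2 n) ⟩
  2 ^ n + 2 ^ n   ≡⟨ cong (2 ^ n +_) (+-identityʳ (2 ^ n)) ⟨
  2 ^ suc n       ∎
  where open ≤-Reasoning

⌊n/2⌋+⌊n/2⌋≤n : ∀ n → ⌊ n /2⌋ + ⌊ n /2⌋ ≤ n
⌊n/2⌋+⌊n/2⌋≤n zero          = z≤n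
⌊n/2⌋+⌊n/2⌋≤n (suc zero)    = z≤n
⌊n/2⌋+⌊n/2⌋≤n (suc (suc n)) =
  s≤s (subst (_≤ suc n) (sym (+-suc ⌊ n /2⌋ ⌊ n /2⌋)) (s≤s (⌊n/2⌋+⌊n/2⌋≤n n)))

3+n≤4*[1+⌊n/2⌋] : ∀ n → 3 + n ≤ 4 * suc ⌊ n /2⌋
3+n≤4*[1+⌊n/2⌋] zero          = s≤s (s≤s (s≤s z≤n))
3+n≤4*[1+⌊n/2⌋] (suc zero)    = ≤-refl
3+n≤4*[1+⌊n/2⌋] (suc (suc n)) =
  subst (5 + n ≤_) (sym (*-suc 4 (suc ⌊ n /2⌋))) (+-monoʳ-≤ 2 (≤-trans (3+n≤4*[1+⌊n/2⌋] n) (m≤n+m _ 2)))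

2^k≤len : ∀ k → 1 ≤ k → 2 ^ k ≤ len k
2^k≤len k 1≤k = subst (2 ^ k ≤_) (sym (+-∸-assoc (2 ^ k) 1≤k)) (m≤m+n (2 ^ k) (k ∸ 1))

k≤len : ∀ k → k ≤ len k
k≤len k = subst (k ≤_) (sym (+-∸-comm k (m^n>0 2 k))) (m≤n+m k (2 ^ k ∸ 1))

len≤2^[1+k] : ∀ k → len k ≤ 2 ^ suc k
len≤2^[1+k] k = begin
  2 ^ k + k ∸ 1       ≤⟨ m∸n≤m (2 ^ k + k) 1 ⟩
  2 ^ k + k           ≤⟨ +-monoʳ-≤ (2 ^ k) (<⇒≤ (n<2^n k)) ⟩
  2 ^ k + 2 ^ k       ≡⟨ cong (2 ^ k +_) (+-identityʳ (2 ^ k)) ⟨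
  2 ^ suc k           ∎
  where open ≤-Reasoning

≤2^⇒⌊log₂⌋≤ : ∀ {m k} → m ≤ 2 ^ k → ⌊log₂ m ⌋ ≤ k
≤2^⇒⌊log₂⌋≤ {k = k} m≤2^k = subst (_ ≤_) (⌊log₂[2^n]⌋≡n k) (⌊log₂⌋-mono-≤ m≤2^k)

2^≤⇒≤⌊log₂⌋ : ∀ {m k} → 2 ^ k ≤ m → k ≤ ⌊log₂ m ⌋
2^≤⇒≤⌊log₂⌋ {k = k} 2^k≤m = subst (_≤ _) (⌊log₂[2^n]⌋≡n k) (⌊log₂⌋-mono-≤ 2^k≤m)

blocks : ∀ b n → suc b < n → ∃[ q ] ∃[ r₀ ] (r₀ ≤ b × suc q * suc b + suc r₀ ≡ n)
blocks b n 1+b<n with m≤n⇒∃[o]m+o≡n 1+b<n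
... | M , refl = M / suc b , M % suc b , ≤-pred (m%n<n M (suc b)) , (begin
  suc (M / suc b) * suc b + suc (M % suc b)     ≡⟨ regroup b (M / suc b) (M % suc b) ⟩
  suc (suc b + (M % suc b + M / suc b * suc b)) ≡⟨ cong (λ x → suc (suc b + x)) (m≡m%n+[m/n]*n M (suc b)) ⟨
  suc (suc b + M)                               ∎)
  where
  open ≡-Reasoning
  regroup : ∀ b q r → suc q * suc b + suc r ≡ suc (suc b + (r + q * suc b))
  regroup = solve-∀

dictionary-cost : ∀ {b k n} → suc k ≤ 4 * suc b → 2 ^ (suc b + suc b) ≤ n →
                  2 ^ suc (suc b) * suc k ≤ 8 * n
dictionary-cost {b} {k} {n} k≤4b 2^2b≤n = begin
  2 * P * suc k           ≤⟨ *-monoʳ-≤ (2 * P) (≤-trans k≤4b (*-monoʳ-≤ 4 (<⇒≤ (n<2^n (suc b))))) ⟩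
  2 * P * (4 * P)         ≡⟨ regroup P ⟩
  8 * (P * P)             ≡⟨ cong (8 *_) (^-distribˡ-+-* 2 (suc b) (suc b)) ⟨
  8 * 2 ^ (suc b + suc b) ≤⟨ *-monoʳ-≤ 8 2^2b≤n ⟩
  8 * n                   ∎
  where
  open ≤-Reasoning
  P = 2 ^ suc b
  regroup : ∀ p → 2 * p * (4 * p) ≡ 8 * (p * p)
  regroup = solve-∀

chain-cost : ∀ {b k q n} → suc k ≤ 4 * suc b → suc q * suc b ≤ n → (2 + q) * suc k ≤ 8 * n
chain-cost {b} {k} {q} {n} k≤4b q*b≤n = begin
  (2 + q) * suc k           ≤⟨ *-mono-≤ 2+q≤2*[1+q] k≤4b ⟩
  (2 * suc q) * (4 * suc b) ≡⟨ regroup (suc q) (suc b) ⟩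
  8 * (suc q * suc b)       ≤⟨ *-monoʳ-≤ 8 q*b≤n ⟩
  8 * n                     ∎
  where
  open ≤-Reasoning
  2+q≤2*[1+q] : 2 + q ≤ 2 * suc q
  2+q≤2*[1+q] = subst (2 + q ≤_) (sym (*-suc 2 q)) (+-monoʳ-≤ 2 (m≤n*m q 2))
  regroup : ∀ x y → 2 * x * (4 * y) ≡ 8 * (x * y)
  regroup = solve-∀

stretch-cost : ∀ {b k q n} → suc b + suc b ≤ k → suc k ≤ 4 * suc b → suc q * suc b ≤ n → 2 ^ k ≤ n →
               (1 + (2 ^ suc (suc b) + suc q)) * suc k ≤ 16 * n
stretch-cost {b} {k} {q} {n} 2b≤k k≤4b q*b≤n 2^k≤n = begin
  (1 + (2 ^ suc (suc b) + suc q)) * suc k   ≡⟨ split (2 ^ suc (suc b)) q (suc k) ⟩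
  2 ^ suc (suc b) * suc k + (2 + q) * suc k ≤⟨ +-mono-≤ (dictionary-cost k≤4b (≤-trans (^-monoʳ-≤ 2 2b≤k) 2^k≤n))
                                                        (chain-cost {q = q} k≤4b q*b≤n) ⟩
  8 * n + 8 * n                             ≡⟨ double n ⟩
  16 * n                                    ∎
  where
  open ≤-Reasoning
  split : ∀ p q y → (1 + (p + suc q)) * y ≡ p * y + (2 + q) * y
  split = solve-∀
  double : ∀ n → 8 * n + 8 * n ≡ 16 * n
  double = solve-∀

halving : ∀ k → 2 ≤ k → ∃[ b ] (suc b + suc b ≤ k × suc k ≤ 4 * suc b)
halving (suc (suc k)) (s≤s (s≤s z≤n)) =
  ⌊ k /2⌋ ,
  s≤s (subst (_≤ suc k) (sym (+-suc ⌊ k /2⌋ ⌊ k /2⌋)) (s≤s (⌊n/2⌋+⌊n/2⌋≤n k))) ,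
  3+n≤4*[1+⌊n/2⌋] k

slp-size-log-bound : ∀ {d k b q s} → 2 ≤ k → suc b + suc b ≤ k → suc k ≤ 4 * suc b →
  suc q * suc b ≤ len k → s ≤ 2 * (2 ^ d * (1 + (2 ^ suc (suc b) + suc q))) →
  s * ⌊log₂ (len k) ⌋ ≤ 32 * 2 ^ d * len k * ⌊log₂ ⌊log₂ (len k) ⌋ ⌋
slp-size-log-bound {d} {k} {b} {q} {s} 2≤k 2b≤k k≤4b q*b≤n s≤ = begin
  s * ⌊log₂ n ⌋                      ≤⟨ *-mono-≤ s≤ (≤2^⇒⌊log₂⌋≤ (len≤2^[1+k] k)) ⟩
  2 * (2 ^ d * (1 + F)) * suc k      ≡⟨ regroup (2 ^ d) (1 + F) (suc k) ⟩
  2 * 2 ^ d * ((1 + F) * suc k)      ≤⟨ *-monoʳ-≤ (2 * 2 ^ d) (stretch-cost 2b≤k k≤4b q*b≤n 2^k≤n) ⟩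
  2 * 2 ^ d * (16 * n)               ≡⟨ rescale (2 ^ d) n ⟩
  32 * 2 ^ d * n * 1                 ≤⟨ *-monoʳ-≤ (32 * 2 ^ d * n) 1≤⌊log₂⌊log₂n⌋⌋ ⟩
  32 * 2 ^ d * n * ⌊log₂ ⌊log₂ n ⌋ ⌋ ∎
  where
  open ≤-Reasoning
  n = len k
  F = 2 ^ suc (suc b) + suc q
  2^k≤n : 2 ^ k ≤ n
  2^k≤n = 2^k≤len k (<⇒≤ 2≤k)
  1≤⌊log₂⌊log₂n⌋⌋ : 1 ≤ ⌊log₂ ⌊log₂ n ⌋ ⌋
  1≤⌊log₂⌊log₂n⌋⌋ = 2^≤⇒≤⌊log₂⌋ {k = 1} (2^≤⇒≤⌊log₂⌋ {k = 2} (≤-trans (^-monoʳ-≤ 2 2≤k) 2^k≤n))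
  regroup : ∀ a x y → 2 * (a * x) * y ≡ 2 * a * (x * y)
  regroup = solve-∀
  rescale : ∀ a n → 2 * a * (16 * n) ≡ 32 * a * n * 1
  rescale = solve-∀

outer-power-slp-bound : ∀ d k (f : ℕ → Bool) → 2 ≤ k →
  ∃[ m ] ∃[ G ] (Generates {d} {Vec Bool d} {m} G (outer (λ _ → word (len k) f)) ×
                 size G * ⌊log₂ (len k) ⌋ ≤ 32 * 2 ^ d * len k * ⌊log₂ ⌊log₂ (len k) ⌋ ⌋)
outer-power-slp-bound d k f 2≤k with halving k 2≤k
... | b , 2b≤k , k≤4b with blocks b (len k) (≤-trans (s≤s (m≤n+m (suc b) b)) (≤-trans 2b≤k (k≤len k)))
... | q , r₀ , r₀≤b , n≡ with outer-power-slp d (len k) f b q r₀ r₀≤b n≡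
... | m , G , gen , size≤ =
  m , G , gen , slp-size-log-bound {d} {q = q} 2≤k 2b≤k k≤4b q*b≤n size≤
  where q*b≤n = subst (suc q * suc b ≤_) n≡ (m≤m+n (suc q * suc b) (suc r₀))

lemma10 : ∃[ C ] ∃[ K ] ((d k : ℕ) → 1 ≤ d → 1 ≤ k → K ≤ k →
            (D : Vec Bool (len k)) → IsDeBruijn k D →
            ∃[ m ] ∃[ G ] (Generates {d} {Vec Bool d} {m} G (B d k D) ×
              size G * ⌊log₂ (len k) ⌋
                ≤ C * 2 ^ d * len k * ⌊log₂ ⌊log₂ (len k) ⌋ ⌋))
lemma10 = 32 , 2 , λ d k _ _ 2≤k D _ → outer-power-slp-bound d k (at D) 2≤k
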